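{- Let $G$ be a graph with independence number $k$ such that $\mathcal{R}_k(G)$ has diameter $d$. Then for every positive integer $n$, there exists a graph $H$ on $|V(G)|+6n+2$ vertices such that $\mathcal{R}_{k+2}(H)$ has diameter at least $2dn$.
   Context: All graphs are finite, simple and undirected. For a graph $G$ and an integer $k\geq 1$, the $k$-configuration graph $\mathcal{R}_k(G)$ (token jumping model) is the graph whose vertices are the independent sets of $G$ of size exactly $k$, where two such independent sets $I,J$ are adjacent if and only if $|I\cap J|=k-1$. Convention: the diameter of a (possibly disconnected) configuration graph means the largest diameter of one of its connected components. -}

module Defs where

open import Data.Nat using (ℕ; zero; suc; _+_; _<_; _≤_)
open import Data.Fin using (Fin)
open import Data.Fin.Subset using (Subset; _∈_; _∩_; ∣_∣)
open import Data.Product using (Σ; ∃; ∃-syntax; _×_; _,_; proj₁)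
open import Relation.Nullary using (¬_; Dec)
open import Relation.Binary.PropositionalEquality using (_≡_)

record Graph : Set₁ where
  field
    n     : ℕ
    Adj   : Fin n → Fin n → Set
    sym   : ∀ {u v} → Adj u v → Adj v u
    irrefl : ∀ {u} → ¬ Adj u u
    dec   : ∀ u v → Dec (Adj u v)
open Graph public

∣V∣ : Graph → ℕ
∣V∣ G = n G

Independent : (G : Graph) → Subset (n G) → Set
Independent G I = ∀ u v → u ∈ I → v ∈ I → ¬ Adj G u v

IsKIndep : (G : Graph) → ℕ → Subset (n G) → Set
IsKIndep G k I = Independent G I × ∣ I ∣ ≡ k

IndependenceNumber : Graph → ℕ → Set
IndependenceNumber G k =
  (∃[ I ] IsKIndep G k I) × (∀ I → Independent G I → ∣ I ∣ ≤ k)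

Conf : Graph → ℕ → Set
Conf G k = Σ (Subset (n G)) (IsKIndep G k)

-- adjacency in R_k(G) (token jumping): |I ∩ J| = k - 1
ConfAdj : (G : Graph) (k : ℕ) → Conf G k → Conf G k → Set
ConfAdj G k I J = suc ∣ proj₁ I ∩ proj₁ J ∣ ≡ k

data Walk (G : Graph) (k : ℕ) : Conf G k → Conf G k → ℕ → Set where
  here : ∀ {I} → Walk G k I I zero
  step : ∀ {I J K ℓ} → ConfAdj G k I J → Walk G k J K ℓ → Walk G k I K (suc ℓ)

Connected : (G : Graph) (k : ℕ) → Conf G k → Conf G k → Set
Connected G k I J = ∃[ ℓ ] Walk G k I J ℓ

DistEq : (G : Graph) (k : ℕ) → Conf G k → Conf G k → ℕ → Set
DistEq G k I J d = Walk G k I J d × (∀ ℓ → ℓ < d → ¬ Walk G k I J ℓ)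

DistGeq : (G : Graph) (k : ℕ) → Conf G k → Conf G k → ℕ → Set
DistGeq G k I J m = Connected G k I J × (∀ ℓ → ℓ < m → ¬ Walk G k I J ℓ)

-- diameter of R_k(G) (= largest diameter of a component) equals d
HasDiameter : Graph → ℕ → ℕ → Set
HasDiameter G k d =
  (∀ I J → Connected G k I J → ∃[ ℓ ] (ℓ ≤ d × Walk G k I J ℓ))
  × (∃[ I ] ∃[ J ] DistEq G k I J d)

DiameterAtLeast : Graph → ℕ → ℕ → Set
DiameterAtLeast G k m = ∃[ I ] ∃[ J ] DistGeq G k I J m

-- Let I, J be configurations of R_k(G) at distance d, with underlying sets A and B.  Glue
-- to G the complement of a path on 3T + 2 vertices (T = 2n) and join gadget vertex 3t to
-- the vertices of G outside A (t even) or B (t odd).  As α(G) = k, an independent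
-- (k + 2)-set of H is an independent k-set of G plus a gadget pair {j, j + 1}, and a token
-- jump either moves a token inside G or slides the pair by one.  While the pair covers 3t,
-- the G-part is forced to be the anchor A or B, so sliding the pair from 0 to 3T makes the
-- G-part travel between A and B, at cost at least d, T times.  Formally, the quantity
-- j + t·d + (length of a G-walk from the t-th anchor to the G-part), with t = ⌊j / 3⌋,
-- grows by at most one per jump, so the two ends are at distance at least T(d + 3) ≥ 2dn.
-- (If A = B then d ≤ 2 and the same bound holds with d replaced by 0.)

module Submission where

open import Defs hiding (sym)
open import Data.Nat using (ℕ; zero; suc; _+_; _*_; _≤_; _<_; z≤n; s≤s)
open import Data.Nat.Properties
open import Data.Nat.Tactic.RingSolver using (solve-∀)
import Data.Bool.Properties as Bool
open import Data.Fin using (Fin; zero; suc; toℕ; fromℕ<; _↑ˡ_; _↑ʳ_; splitAt)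
open import Data.Fin.Properties using (toℕ-fromℕ<; toℕ≤pred[n]; splitAt-↑ˡ; splitAt-↑ʳ)
open import Data.Fin.Subset using (Subset; _∈_; _∉_; _⊆_; _∩_; ∣_∣; Nonempty; inside; outside; ⊤) renaming (⊥ to ∅)
open import Data.Fin.Subset.Properties
  using (_∈?_; ⊆⊤; ⊆-refl; ∩-comm; ∩-idem; ∩-zeroˡ; p∩q⊆p; p∩q⊆q; ∣p∩q∣≤∣p∣; p⊆q⇒∣p∣≤∣q∣; drop-∷-⊆;
         ∣⊥∣≡0; Empty-unique; nonempty?; ∉⊥)
open import Data.Vec using ([]; _∷_; _++_; here; there)
import Data.Vec as Vec
open import Data.Vec.Properties using (zipWith-++; lookup-splitAt; lookup-++ˡ; lookup-++ʳ; []=⇒lookup; lookup⇒[]=; ++-injectiveʳ; ≡-dec)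
open import Data.Product using (∃-syntax; ∃₂; _×_; _,_; proj₁; proj₂)
open import Data.Sum using (_⊎_; inj₁; inj₂; [_,_]′; map)
open import Relation.Nullary using (¬_; ¬?; Dec; yes; no; contradiction)
open import Relation.Nullary.Decidable using (_⊎-dec_)
open import Relation.Binary.PropositionalEquality

∣p++q∣≡∣p∣+∣q∣ : ∀ {a b} (p : Subset a) (q : Subset b) → ∣ p ++ q ∣ ≡ ∣ p ∣ + ∣ q ∣
∣p++q∣≡∣p∣+∣q∣ []            q = refl
∣p++q∣≡∣p∣+∣q∣ (inside  ∷ p) q = cong suc (∣p++q∣≡∣p∣+∣q∣ p q)
∣p++q∣≡∣p∣+∣q∣ (outside ∷ p) q = ∣p++q∣≡∣p∣+∣q∣ p q

∣p++q∩r++s∣ : ∀ {a b} (p r : Subset a) (q s : Subset b) →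
              ∣ (p ++ q) ∩ (r ++ s) ∣ ≡ ∣ p ∩ r ∣ + ∣ q ∩ s ∣
∣p++q∩r++s∣ p r q s = begin
  ∣ (p ++ q) ∩ (r ++ s) ∣   ≡⟨ cong ∣_∣ (zipWith-++ _ p q r s) ⟩
  ∣ (p ∩ r) ++ (q ∩ s) ∣    ≡⟨ ∣p++q∣≡∣p∣+∣q∣ (p ∩ r) (q ∩ s) ⟩
  ∣ p ∩ r ∣ + ∣ q ∩ s ∣     ∎
  where open ≡-Reasoning

p⊆q∧∣q∣≤∣p∣⇒p≡q : ∀ {a} {p q : Subset a} → p ⊆ q → ∣ q ∣ ≤ ∣ p ∣ → p ≡ q
p⊆q∧∣q∣≤∣p∣⇒p≡q {p = []}          {[]}          _   _ = refl
p⊆q∧∣q∣≤∣p∣⇒p≡q {p = outside ∷ p} {outside ∷ q} p⊆q h =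
  cong (outside ∷_) (p⊆q∧∣q∣≤∣p∣⇒p≡q (drop-∷-⊆ p⊆q) h)
p⊆q∧∣q∣≤∣p∣⇒p≡q {p = outside ∷ p} {inside  ∷ q} p⊆q h =
  contradiction h (<⇒≱ (s≤s (p⊆q⇒∣p∣≤∣q∣ (drop-∷-⊆ p⊆q))))
p⊆q∧∣q∣≤∣p∣⇒p≡q {p = inside  ∷ p} {outside ∷ q} p⊆q h with p⊆q here
... | ()
p⊆q∧∣q∣≤∣p∣⇒p≡q {p = inside  ∷ p} {inside  ∷ q} p⊆q (s≤s h) =
  cong (inside ∷_) (p⊆q∧∣q∣≤∣p∣⇒p≡q (drop-∷-⊆ p⊆q) h)

1≤∣p∣⇒Nonempty : ∀ {a} (p : Subset a) → 1 ≤ ∣ p ∣ → Nonempty p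
1≤∣p∣⇒Nonempty {a} p 1≤∣p∣ with nonempty? p
... | yes ne = ne
... | no  ¬ne = contradiction (trans (cong ∣_∣ (Empty-unique ¬ne)) (∣⊥∣≡0 a))
                              (λ ∣p∣≡0 → <⇒≱ 1≤∣p∣ (≤-reflexive ∣p∣≡0))

TokenJump : ∀ {a} → ℕ → Subset a → Subset a → Set
TokenJump k I J = suc ∣ I ∩ J ∣ ≡ k

TokenJump-sym : ∀ {a k} {I J : Subset a} → TokenJump k I J → TokenJump k J I
TokenJump-sym {I = I} {J} = subst (λ X → suc ∣ X ∣ ≡ _) (∩-comm I J)

data SetWalk (G : Graph) (k : ℕ) : Subset (n G) → Subset (n G) → ℕ → Set where
  done : ∀ {I} → SetWalk G k I I zero
  jump : ∀ {I J K ℓ} → IsKIndep G k J → TokenJump k I J → SetWalk G k J K ℓ → SetWalk G k I K (suc ℓ)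

module _ {G : Graph} {k : ℕ} where

  _++ʷ_ : ∀ {I J K a b} → SetWalk G k I J a → SetWalk G k J K b → SetWalk G k I K (a + b)
  done            ++ʷ w′ = w′
  jump J-ind I⇝J w ++ʷ w′ = jump J-ind I⇝J (w ++ʷ w′)

  snoc : ∀ {I J K ℓ} → SetWalk G k I J ℓ → IsKIndep G k K → TokenJump k J K → SetWalk G k I K (suc ℓ)
  snoc done             K-ind J⇝K = jump K-ind J⇝K done
  snoc (jump J-ind I⇝J w) K-ind J⇝K = jump J-ind I⇝J (snoc w K-ind J⇝K)

  reverse : ∀ {I J ℓ} → IsKIndep G k I → SetWalk G k I J ℓ → SetWalk G k J I ℓ
  reverse I-ind done             = done
  reverse {I} I-ind (jump {J = J} J-ind I⇝J w) = snoc (reverse J-ind w) I-ind (TokenJump-sym {I = I} {J} I⇝J)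

  SetWalk-0 : ∀ {I J} → SetWalk G k I J 0 → I ≡ J
  SetWalk-0 done = refl

  fromWalk : ∀ {I J ℓ} → Walk G k I J ℓ → SetWalk G k (proj₁ I) (proj₁ J) ℓ
  fromWalk here                   = done
  fromWalk (step {J = J} I⇝J w) = jump (proj₂ J) I⇝J (fromWalk w)

  toWalk : ∀ (I : Conf G k) {K ℓ} → SetWalk G k (proj₁ I) K ℓ → ∃[ J ] proj₁ J ≡ K × Walk G k I J ℓ
  toWalk I done = I , refl , here
  toWalk I (jump J-ind I⇝J w) with toWalk (_ , J-ind) w
  ... | K , refl , w′ = K , refl , step I⇝J w′

  -- The end J is prescribed, which needs a step: distinct configurations may share their set.
  toWalk-suc : ∀ (I J : Conf G k) {ℓ} → SetWalk G k (proj₁ I) (proj₁ J) (suc ℓ) → Walk G k I J (suc ℓ)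
  toWalk-suc I J (jump J-ind I⇝J done)       = step I⇝J here
  toWalk-suc I J (jump J-ind I⇝J w@(jump _ _ _)) = step I⇝J (toWalk-suc (_ , J-ind) J w)

  module _ (P : Subset (n G) → ℕ → Set)
           (P-jump : ∀ {I J p} → P I p → IsKIndep G k J → TokenJump k I J → P J (suc p)) where

    potential-walk : ∀ {I J ℓ p} → SetWalk G k I J ℓ → P I p → P J (ℓ + p)
    potential-walk done P-I = P-I
    potential-walk {ℓ = suc ℓ} {p} (jump J-ind I⇝J w) P-I =
      subst (P _) (+-suc ℓ p) (potential-walk w (P-jump P-I J-ind I⇝J))

module Glue (G₁ G₂ : Graph) (L : Fin (n G₂) → Subset (n G₁)) where

  private
    n₁ = n G₁
    n₂ = n G₂
    Vertex = Fin n₁ ⊎ Fin n₂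

    Adj⊎ : Vertex → Vertex → Set
    Adj⊎ (inj₁ a) (inj₁ b) = Adj G₁ a b
    Adj⊎ (inj₁ a) (inj₂ i) = a ∉ L i
    Adj⊎ (inj₂ i) (inj₁ a) = a ∉ L i
    Adj⊎ (inj₂ i) (inj₂ j) = Adj G₂ i j

    Adj⊎-sym : ∀ x y → Adj⊎ x y → Adj⊎ y x
    Adj⊎-sym (inj₁ a) (inj₁ b) = Graph.sym G₁
    Adj⊎-sym (inj₁ a) (inj₂ i) a∉ = a∉
    Adj⊎-sym (inj₂ i) (inj₁ a) a∉ = a∉
    Adj⊎-sym (inj₂ i) (inj₂ j) = Graph.sym G₂

    Adj⊎-irrefl : ∀ x → ¬ Adj⊎ x x
    Adj⊎-irrefl (inj₁ a) = irrefl G₁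
    Adj⊎-irrefl (inj₂ i) = irrefl G₂

    Adj⊎? : ∀ x y → Dec (Adj⊎ x y)
    Adj⊎? (inj₁ a) (inj₁ b) = dec G₁ a b
    Adj⊎? (inj₁ a) (inj₂ i) = ¬? (a ∈? L i)
    Adj⊎? (inj₂ i) (inj₁ a) = ¬? (a ∈? L i)
    Adj⊎? (inj₂ i) (inj₂ j) = dec G₂ i j

  graph : Graph
  graph = record
    { n      = n₁ + n₂
    ; Adj    = λ u v → Adj⊎ (splitAt n₁ u) (splitAt n₁ v)
    ; sym    = λ {u} {v} → Adj⊎-sym (splitAt n₁ u) (splitAt n₁ v)
    ; irrefl = λ {u} → Adj⊎-irrefl (splitAt n₁ u)
    ; dec    = λ u v → Adj⊎? (splitAt n₁ u) (splitAt n₁ v)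
    }

  module _ {xs : Subset n₁} {ys : Subset n₂} where

    private
      In : Vertex → Set
      In = [ _∈ xs , _∈ ys ]′

    ∈-++⁻ : ∀ u → u ∈ xs ++ ys → In (splitAt n₁ u)
    ∈-++⁻ u u∈ with splitAt n₁ u | lookup-splitAt n₁ xs ys u
    ... | inj₁ a | eq = lookup⇒[]= a xs (trans (sym eq) ([]=⇒lookup u∈))
    ... | inj₂ i | eq = lookup⇒[]= i ys (trans (sym eq) ([]=⇒lookup u∈))

    ∈-++⁺ˡ : ∀ {a} → a ∈ xs → a ↑ˡ n₂ ∈ xs ++ ys
    ∈-++⁺ˡ {a} a∈ = lookup⇒[]= _ (xs ++ ys) (trans (lookup-++ˡ xs ys a) ([]=⇒lookup a∈))

    ∈-++⁺ʳ : ∀ {i} → i ∈ ys → n₁ ↑ʳ i ∈ xs ++ ys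
    ∈-++⁺ʳ {i} i∈ = lookup⇒[]= _ (xs ++ ys) (trans (lookup-++ʳ xs ys i) ([]=⇒lookup i∈))

    independent-++⁺ : Independent G₁ xs → Independent G₂ ys → (∀ i → i ∈ ys → xs ⊆ L i) →
                      Independent graph (xs ++ ys)
    independent-++⁺ xs-ind ys-ind ys⊆ u v u∈ v∈ =
      no-edge (splitAt n₁ u) (splitAt n₁ v) (∈-++⁻ u u∈) (∈-++⁻ v v∈)
      where
      no-edge : ∀ x y → In x → In y → ¬ Adj⊎ x y
      no-edge (inj₁ a) (inj₁ b) a∈ b∈ = xs-ind a b a∈ b∈
      no-edge (inj₁ a) (inj₂ i) a∈ i∈ = contradiction (ys⊆ i i∈ a∈)
      no-edge (inj₂ i) (inj₁ a) i∈ a∈ = contradiction (ys⊆ i i∈ a∈)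
      no-edge (inj₂ i) (inj₂ j) i∈ j∈ = ys-ind i j i∈ j∈

    independent-++⁻ : Independent graph (xs ++ ys) →
                      Independent G₁ xs × Independent G₂ ys × (∀ i → i ∈ ys → xs ⊆ L i)
    independent-++⁻ ind = xs-ind , ys-ind , ys⊆
      where
      xs-ind : Independent G₁ xs
      xs-ind a b a∈ b∈ a~b = ind (a ↑ˡ n₂) (b ↑ˡ n₂) (∈-++⁺ˡ a∈) (∈-++⁺ˡ b∈)
        (subst₂ Adj⊎ (sym (splitAt-↑ˡ n₁ a n₂)) (sym (splitAt-↑ˡ n₁ b n₂)) a~b)
      ys-ind : Independent G₂ ys
      ys-ind i j i∈ j∈ i~j = ind (n₁ ↑ʳ i) (n₁ ↑ʳ j) (∈-++⁺ʳ i∈) (∈-++⁺ʳ j∈)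
        (subst₂ Adj⊎ (sym (splitAt-↑ʳ n₁ n₂ i)) (sym (splitAt-↑ʳ n₁ n₂ j)) i~j)
      ys⊆ : ∀ i → i ∈ ys → xs ⊆ L i
      ys⊆ i i∈ {a} a∈ with a ∈? L i
      ... | yes a∈L = a∈L
      ... | no  a∉L = contradiction
        (subst₂ Adj⊎ (sym (splitAt-↑ˡ n₁ a n₂)) (sym (splitAt-↑ʳ n₁ n₂ i)) a∉L)
        (ind (a ↑ˡ n₂) (n₁ ↑ʳ i) (∈-++⁺ˡ a∈) (∈-++⁺ʳ i∈))

Apart : ∀ {m} → Fin m → Fin m → Set
Apart i j = suc (toℕ i) < toℕ j ⊎ suc (toℕ j) < toℕ i

pathComplement : ℕ → Graph
pathComplement m = record
  { n      = m
  ; Adj    = Apart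
  ; sym    = λ { (inj₁ i<j) → inj₂ i<j ; (inj₂ j<i) → inj₁ j<i }
  ; irrefl = λ { (inj₁ i<i) → <-irrefl refl (<-trans (n<1+n _) i<i)
               ; (inj₂ i<i) → <-irrefl refl (<-trans (n<1+n _) i<i) }
  ; dec    = λ i j → (suc (toℕ i) <? toℕ j) ⊎-dec (suc (toℕ j) <? toℕ i)
  }

-- {j, j + 1} as a subset of Fin m (truncated when j + 1 ≥ m).
pair : ∀ m → ℕ → Subset m
pair zero          _       = []
pair (suc m)       (suc j) = outside ∷ pair m j
pair (suc zero)    zero    = inside ∷ []
pair (suc (suc m)) zero    = inside ∷ inside ∷ ∅

∈pair⁻ : ∀ {m} j (i : Fin m) → i ∈ pair m j → toℕ i ≡ j ⊎ toℕ i ≡ suc j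
∈pair⁻ {suc zero}    zero    zero          _                 = inj₁ refl
∈pair⁻ {suc (suc m)} zero    zero          _                 = inj₁ refl
∈pair⁻ {suc (suc m)} zero    (suc zero)    _                 = inj₂ refl
∈pair⁻ {suc (suc m)} zero    (suc (suc i)) (there (there i∈)) = contradiction i∈ ∉⊥
∈pair⁻ {suc m}       (suc j) (suc i)       (there i∈)        with ∈pair⁻ j i i∈
... | inj₁ i≡j  = inj₁ (cong suc i≡j)
... | inj₂ i≡1+j = inj₂ (cong suc i≡1+j)

∈pair⁺ : ∀ {m} j (i : Fin m) → toℕ i ≡ j ⊎ toℕ i ≡ suc j → i ∈ pair m j
∈pair⁺ {suc zero}    zero    zero          _ = here
∈pair⁺ {suc (suc m)} zero    zero          _ = here
∈pair⁺ {suc (suc m)} zero    (suc zero)    _ = there here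
∈pair⁺ {suc (suc m)} zero    (suc (suc i)) (inj₁ ())
∈pair⁺ {suc (suc m)} zero    (suc (suc i)) (inj₂ ())
∈pair⁺ {suc m}       (suc j) zero          (inj₁ ())
∈pair⁺ {suc m}       (suc j) zero          (inj₂ ())
∈pair⁺ {suc m}       (suc j) (suc i)       i≡ =
  there (∈pair⁺ j i (map suc-injective suc-injective i≡))

∣pair∣≡2 : ∀ {m} j → 2 + j ≤ m → ∣ pair m j ∣ ≡ 2
∣pair∣≡2 {suc (suc m)} zero    _       = cong (2 +_) (∣⊥∣≡0 m)
∣pair∣≡2 {suc m}       (suc j) (s≤s v) = ∣pair∣≡2 j v

∣pair∩pair∣≡2 : ∀ {m} j → 2 + j ≤ m → ∣ pair m j ∩ pair m j ∣ ≡ 2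
∣pair∩pair∣≡2 {m} j v = trans (cong ∣_∣ (∩-idem (pair m j))) (∣pair∣≡2 j v)

∣pair∩pair-suc∣≡1 : ∀ {m} j → 3 + j ≤ m → ∣ pair m j ∩ pair m (suc j) ∣ ≡ 1
∣pair∩pair-suc∣≡1 {suc (suc zero)}    zero    (s≤s (s≤s ()))
∣pair∩pair-suc∣≡1 {suc (suc (suc m))} zero    _ =
  cong suc (trans (cong ∣_∣ (∩-zeroˡ {suc m} (inside ∷ ∅))) (∣⊥∣≡0 (suc m)))
∣pair∩pair-suc∣≡1 {suc m}             (suc j) (s≤s v) = ∣pair∩pair-suc∣≡1 j v

pair-independent : ∀ {m} j → Independent (pathComplement m) (pair m j)
pair-independent j i i′ i∈ i′∈ = not-apart (∈pair⁻ j i i∈) (∈pair⁻ j i′ i′∈)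
  where
  within : ∀ {x y} → x ≡ j ⊎ x ≡ suc j → y ≡ j ⊎ y ≡ suc j → y ≤ suc x
  within (inj₁ refl) (inj₁ refl) = n≤1+n _
  within (inj₁ refl) (inj₂ refl) = ≤-refl
  within (inj₂ refl) (inj₁ refl) = ≤-trans (n≤1+n _) (n≤1+n _)
  within (inj₂ refl) (inj₂ refl) = n≤1+n _
  not-apart : ∀ {i i′ : Fin _} → toℕ i ≡ j ⊎ toℕ i ≡ suc j → toℕ i′ ≡ j ⊎ toℕ i′ ≡ suc j →
              ¬ Apart i i′
  not-apart i≡ i′≡ (inj₁ i<i′) = <⇒≱ i<i′ (within i≡ i′≡)
  not-apart i≡ i′≡ (inj₂ i′<i) = <⇒≱ i′<i (within i′≡ i≡)

independent-tail : ∀ {m x} {ys : Subset m} →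
                   Independent (pathComplement (suc m)) (x ∷ ys) → Independent (pathComplement m) ys
independent-tail ind i j i∈ j∈ i-j = ind (suc i) (suc j) (there i∈) (there j∈) (map s≤s s≤s i-j)

pathComplement-independent : ∀ {m} {ys : Subset m} → Independent (pathComplement m) ys →
                             ∣ ys ∣ ≤ 1 ⊎ ∃[ j ] 2 + j ≤ m × ys ≡ pair m j
pathComplement-independent {zero}  {[]} _ = inj₁ z≤n
pathComplement-independent {suc m} {outside ∷ ys} ind
  with pathComplement-independent (independent-tail ind)
... | inj₁ ∣ys∣≤1            = inj₁ ∣ys∣≤1
... | inj₂ (j , v , refl)    = inj₂ (suc j , s≤s v , refl)
pathComplement-independent {suc zero}    {inside ∷ []} _ = inj₁ ≤-refl
pathComplement-independent {suc (suc m)} {inside ∷ y ∷ zs} ind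
  with Empty-unique {p = zs} (λ (i , i∈) → ind zero (suc (suc i)) here (there (there i∈)) (inj₁ (s≤s (s≤s z≤n))))
pathComplement-independent {suc (suc m)} {inside ∷ outside ∷ zs} ind | refl = inj₁ (s≤s (≤-reflexive (∣⊥∣≡0 m)))
pathComplement-independent {suc (suc m)} {inside ∷ inside ∷ zs}  ind | refl = inj₂ (0 , s≤s (s≤s z≤n) , refl)

meeting-pairs : ∀ {x j j′ : ℕ} → x ≡ j ⊎ x ≡ suc j → x ≡ j′ ⊎ x ≡ suc j′ →
                j ≡ j′ ⊎ j′ ≡ suc j ⊎ j ≡ suc j′
meeting-pairs (inj₁ refl) (inj₁ refl) = inj₁ refl
meeting-pairs (inj₁ refl) (inj₂ refl) = inj₂ (inj₂ refl)
meeting-pairs (inj₂ refl) (inj₁ refl) = inj₂ (inj₁ refl)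
meeting-pairs (inj₂ refl) (inj₂ refl) = inj₁ refl

data Overlap (m j j′ : ℕ) : Set where
  same     : j ≡ j′ → Overlap m j j′
  adjacent : ∣ pair m j ∩ pair m j′ ∣ ≡ 1 → j′ ≡ suc j ⊎ j ≡ suc j′ → Overlap m j j′
  disjoint : ∣ pair m j ∩ pair m j′ ∣ ≡ 0 → Overlap m j j′

pair-overlap : ∀ {m} j j′ → 2 + j ≤ m → 2 + j′ ≤ m → Overlap m j j′
pair-overlap {m} j j′ v v′ with j ≟ j′ | ∣ pair m j ∩ pair m j′ ∣ in c≡
... | yes j≡j′ | _     = same j≡j′
... | no  _    | zero  = disjoint c≡
... | no  j≢j′ | suc c
  with 1≤∣p∣⇒Nonempty (pair m j ∩ pair m j′) (≤-trans (s≤s z≤n) (≤-reflexive (sym c≡)))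
...   | i , i∈ with meeting-pairs (∈pair⁻ j i (p∩q⊆p _ _ i∈)) (∈pair⁻ j′ i (p∩q⊆q _ _ i∈))
... | inj₁ j≡j′          = contradiction j≡j′ j≢j′
... | inj₂ (inj₁ refl)   = adjacent (∣pair∩pair-suc∣≡1 j v′) (inj₁ refl)
... | inj₂ (inj₂ refl)   =
  adjacent (trans (cong ∣_∣ (∩-comm (pair m j) _)) (∣pair∩pair-suc∣≡1 j′ v)) (inj₂ refl)

pair-injective : ∀ {m} j j′ → 2 + j ≤ m → 2 + j′ ≤ m → pair m j ≡ pair m j′ → j ≡ j′
pair-injective {m} j j′ v v′ eq
  with pair-overlap j j′ v v′ | trans (sym (∣pair∩pair∣≡2 j v)) (cong (λ p → ∣ pair m j ∩ p ∣) eq)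
... | same j≡j′      | _   = j≡j′
... | adjacent c≡1 _ | 2≡c = contradiction (trans 2≡c c≡1) λ ()
... | disjoint c≡0   | 2≡c = contradiction (trans 2≡c c≡0) λ ()

data PairMove {a} (k : ℕ) (xs xs′ : Subset a) (j j′ : ℕ) : Set where
  jumpˡ  : j ≡ j′ → TokenJump k xs xs′ → PairMove k xs xs′ j j′
  slide⁺ : xs ≡ xs′ → j′ ≡ suc j → PairMove k xs xs′ j j′
  slide⁻ : xs ≡ xs′ → j ≡ suc j′ → PairMove k xs xs′ j j′

TokenJump-++ : ∀ {a b k} (p r : Subset a) (q s : Subset b) →
               TokenJump k (p ++ q) (r ++ s) → suc ∣ p ∩ r ∣ + ∣ q ∩ s ∣ ≡ k
TokenJump-++ p r q s = trans (cong suc (sym (∣p++q∩r++s∣ p r q s)))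

pair-move : ∀ {a k m} {xs xs′ : Subset a} {j j′} →
            ∣ xs ∣ ≡ k → ∣ xs′ ∣ ≡ k → 2 + j ≤ m → 2 + j′ ≤ m →
            TokenJump (k + 2) (xs ++ pair m j) (xs′ ++ pair m j′) → PairMove k xs xs′ j j′
pair-move {k = k} {m} {xs} {xs′} {j} {j′} ∣xs∣ ∣xs′∣ v v′ J
  with pair-overlap j j′ v v′ | TokenJump-++ xs xs′ (pair m j) (pair m j′) J
... | same refl | counts =
  jumpˡ refl (+-cancelʳ-≡ 2 _ k
    (subst (λ c → suc ∣ xs ∩ xs′ ∣ + c ≡ k + 2) (∣pair∩pair∣≡2 j v) counts))
... | adjacent c≡1 j~j′ | counts = [ slide⁺ xs≡xs′ , slide⁻ xs≡xs′ ]′ j~j′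
  where
  ∣xs∩xs′∣≡k : ∣ xs ∩ xs′ ∣ ≡ k
  ∣xs∩xs′∣≡k = suc-injective (+-cancelʳ-≡ 1 _ _
    (trans (subst (λ c → suc ∣ xs ∩ xs′ ∣ + c ≡ k + 2) c≡1 counts) (+-suc k 1)))
  xs∩xs′≡ : ∀ {ys} → xs ∩ xs′ ⊆ ys → ∣ ys ∣ ≡ k → xs ∩ xs′ ≡ ys
  xs∩xs′≡ ⊆ys ∣ys∣ = p⊆q∧∣q∣≤∣p∣⇒p≡q ⊆ys (≤-reflexive (trans ∣ys∣ (sym ∣xs∩xs′∣≡k)))
  xs≡xs′ : xs ≡ xs′
  xs≡xs′ = trans (sym (xs∩xs′≡ (p∩q⊆p xs xs′) ∣xs∣)) (xs∩xs′≡ (p∩q⊆q xs xs′) ∣xs′∣)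
... | disjoint c≡0 | counts = contradiction (subst (_≤ k) ∣xs∩xs′∣≡k+1 ∣xs∩xs′∣≤k) (m+1+n≰m k)
  where
  ∣xs∩xs′∣≡k+1 : ∣ xs ∩ xs′ ∣ ≡ k + 1
  ∣xs∩xs′∣≡k+1 = suc-injective (begin
    suc ∣ xs ∩ xs′ ∣      ≡⟨ +-identityʳ _ ⟨
    suc ∣ xs ∩ xs′ ∣ + 0  ≡⟨ subst (λ c → suc ∣ xs ∩ xs′ ∣ + c ≡ k + 2) c≡0 counts ⟩
    k + 2                 ≡⟨ +-suc k 1 ⟩
    suc (k + 1)           ∎)
    where open ≡-Reasoning
  ∣xs∩xs′∣≤k : ∣ xs ∩ xs′ ∣ ≤ k
  ∣xs∩xs′∣≤k = subst (_ ≤_) ∣xs∣ (∣p∩q∣≤∣p∣ xs xs′)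

alternating : ∀ {ℓ} {X : Set ℓ} → X → X → ℕ → X
alternating x y zero    = x
alternating x y (suc t) = alternating y x t

alternating-all : ∀ {ℓ} {X : Set ℓ} (P : X → Set) {x y} → P x → P y → ∀ t → P (alternating x y t)
alternating-all P Px Py zero    = Px
alternating-all P Px Py (suc t) = alternating-all P Py Px t

zoneLock : ∀ {a} → Subset a → Subset a → ℕ → Subset a
zoneLock A B zero                = A
zoneLock A B (suc zero)          = ⊤
zoneLock A B (suc (suc zero))    = ⊤
zoneLock A B (suc (suc (suc j))) = zoneLock B A j

zoneLock-anchor : ∀ {a} (A B : Subset a) t → zoneLock A B (t * 3) ≡ alternating A B t
zoneLock-anchor A B zero    = refl
zoneLock-anchor A B (suc t) = zoneLock-anchor B A t

zoneLock-free₁ : ∀ {a} (A B : Subset a) t → zoneLock A B (1 + t * 3) ≡ ⊤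
zoneLock-free₁ A B zero    = refl
zoneLock-free₁ A B (suc t) = zoneLock-free₁ B A t

zoneLock-free₂ : ∀ {a} (A B : Subset a) t → zoneLock A B (2 + t * 3) ≡ ⊤
zoneLock-free₂ A B zero    = refl
zoneLock-free₂ A B (suc t) = zoneLock-free₂ B A t

record SetDistance (G : Graph) (k : ℕ) (I J : Subset (n G)) (δ : ℕ) : Set where
  field
    walk    : SetWalk G k I J δ
    minimal : ∀ {ℓ} → SetWalk G k I J ℓ → δ ≤ ℓ

SetDistance-sym : ∀ {G k I J δ} → IsKIndep G k I → IsKIndep G k J →
                  SetDistance G k I J δ → SetDistance G k J I δ
SetDistance-sym I-ind J-ind I↔J = record
  { walk    = reverse I-ind (SetDistance.walk I↔J)
  ; minimal = λ w → SetDistance.minimal I↔J (reverse J-ind w)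
  }

alternating-distance : ∀ {G k I J δ} → SetDistance G k I J δ → SetDistance G k J I δ →
                       ∀ t → SetDistance G k (alternating I J t) (alternating I J (suc t)) δ
alternating-distance I↔J J↔I zero    = I↔J
alternating-distance I↔J J↔I (suc t) = alternating-distance J↔I I↔J t

DistEq-same-set : ∀ {G k d} (I J : Conf G k) → proj₁ I ≡ proj₁ J → DistEq G k I J d → d ≤ 2
DistEq-same-set {d = zero}                _ _ _ _ = z≤n
DistEq-same-set {d = suc zero}            _ _ _ _ = s≤s z≤n
DistEq-same-set {d = suc (suc zero)}      _ _ _ _ = ≤-refl
DistEq-same-set {k = k} {suc (suc (suc d))} I J I≡J (step {J = X} I⇝X _ , shortest) =
  contradiction (step {J = X} I⇝X (step {J = J} X⇝J here)) (shortest 2 (s≤s (s≤s (s≤s z≤n))))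
  where
  X⇝J : TokenJump k (proj₁ X) (proj₁ J)
  X⇝J = subst (TokenJump k (proj₁ X)) I≡J (TokenJump-sym {I = proj₁ I} {proj₁ X} I⇝X)

DistEq⇒SetDistance : ∀ {G k d} (I J : Conf G k) → DistEq G k I J d →
                     ∃[ δ ] d ≤ 2 + δ × SetDistance G k (proj₁ I) (proj₁ J) δ
DistEq⇒SetDistance {G} {k} {d} I J dist@(I⇝J , shortest) with ≡-dec Bool._≟_ (proj₁ I) (proj₁ J)
... | yes I≡J = 0 , DistEq-same-set I J I≡J dist , record
  { walk = subst (λ X → SetWalk G k (proj₁ I) X 0) I≡J done ; minimal = λ _ → z≤n }
... | no  I≢J = d , m≤n+m d 2 , record { walk = fromWalk I⇝J ; minimal = minimal }
  where
  minimal : ∀ {ℓ} → SetWalk G k (proj₁ I) (proj₁ J) ℓ → d ≤ ℓ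
  minimal {zero}  w = contradiction (SetWalk-0 w) I≢J
  minimal {suc ℓ} w with d ≤? suc ℓ
  ... | yes d≤ℓ = d≤ℓ
  ... | no  d≰ℓ = contradiction (toWalk-suc I J w) (shortest (suc ℓ) (≰⇒> d≰ℓ))

zone-≤ : ∀ (s : Fin 3) t u → u * 3 ≡ toℕ s + t * 3 → u ≤ t
zone-≤ s t u eq with u ≤? t
... | yes u≤t = u≤t
... | no  u≰t = contradiction (≤-trans (*-monoˡ-≤ 3 (≰⇒> u≰t)) (≤-reflexive eq))
                              (<⇒≱ (s≤s (+-monoˡ-≤ (t * 3) (toℕ≤pred[n] s))))

DiameterAtLeast-mono : ∀ {G k d d′} → d′ ≤ d → DiameterAtLeast G k d → DiameterAtLeast G k d′
DiameterAtLeast-mono d′≤d (I , J , connected , far) =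
  I , J , connected , λ ℓ ℓ<d′ → far ℓ (≤-trans ℓ<d′ d′≤d)

module Construction (G : Graph) (k : ℕ) (α≤k : ∀ I → Independent G I → ∣ I ∣ ≤ k)
                    {A B : Subset (n G)} (A-ind : IsKIndep G k A) (B-ind : IsKIndep G k B)
                    {δ : ℕ} (A↔B : SetDistance G k A B δ) (T : ℕ) where

  m : ℕ
  m = 2 + T * 3

  lock anchor : ℕ → Subset (n G)
  lock   = zoneLock A B
  anchor = alternating A B

  anchor-ind : ∀ t → IsKIndep G k (anchor t)
  anchor-ind = alternating-all (IsKIndep G k) A-ind B-ind

  anchor-distance : ∀ t → SetDistance G k (anchor t) (anchor (suc t)) δ
  anchor-distance = alternating-distance A↔B (SetDistance-sym A-ind B-ind A↔B)

  anchor-fix : ∀ {xs} t → xs ⊆ anchor t → ∣ xs ∣ ≡ k → xs ≡ anchor t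
  anchor-fix t xs⊆ ∣xs∣ =
    p⊆q∧∣q∣≤∣p∣⇒p≡q xs⊆ (≤-reflexive (trans (proj₂ (anchor-ind t)) (sym ∣xs∣)))

  open Glue G (pathComplement m) (λ i → lock (toℕ i)) using (graph; independent-++⁺; independent-++⁻)

  H : Graph
  H = graph

  Compatible : Subset (n G) → ℕ → Set
  Compatible xs j = xs ⊆ lock j × xs ⊆ lock (suc j)

  free-compatible : ∀ t xs → Compatible xs (1 + t * 3)
  free-compatible t xs = subst (xs ⊆_) (sym (zoneLock-free₁ A B t)) ⊆⊤
                       , subst (xs ⊆_) (sym (zoneLock-free₂ A B t)) ⊆⊤

  anchor-compatible₀ : ∀ t → Compatible (anchor t) (t * 3)
  anchor-compatible₀ t = subst (anchor t ⊆_) (sym (zoneLock-anchor A B t)) ⊆-refl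
                       , subst (anchor t ⊆_) (sym (zoneLock-free₁ A B t)) ⊆⊤

  anchor-compatible₂ : ∀ t → Compatible (anchor (suc t)) (2 + t * 3)
  anchor-compatible₂ t = subst (anchor (suc t) ⊆_) (sym (zoneLock-free₂ A B t)) ⊆⊤
                       , subst (anchor (suc t) ⊆_) (sym (zoneLock-anchor A B (suc t))) ⊆-refl

  record Glued (S : Subset (n H)) (xs : Subset (n G)) (j : ℕ) : Set where
    constructor glued
    field
      split      : S ≡ xs ++ pair m j
      xs-ind     : IsKIndep G k xs
      valid      : 2 + j ≤ m
      compatible : Compatible xs j

  glued-ind : ∀ {xs j} → IsKIndep G k xs → 2 + j ≤ m → Compatible xs j → IsKIndep H (k + 2) (xs ++ pair m j)
  glued-ind {xs} {j} (xs-ind , ∣xs∣) v (⊆lock-j , ⊆lock-suc-j) =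
    independent-++⁺ xs-ind (pair-independent j) pair⊆ ,
    trans (∣p++q∣≡∣p∣+∣q∣ xs (pair m j)) (cong₂ _+_ ∣xs∣ (∣pair∣≡2 j v))
    where
    pair⊆ : ∀ i → i ∈ pair m j → xs ⊆ lock (toℕ i)
    pair⊆ i i∈ = [ (λ i≡j → subst (λ x → xs ⊆ lock x) (sym i≡j) ⊆lock-j)
                 , (λ i≡1+j → subst (λ x → xs ⊆ lock x) (sym i≡1+j) ⊆lock-suc-j) ]′ (∈pair⁻ j i i∈)

  decompose : ∀ {S} → IsKIndep H (k + 2) S → ∃₂ (Glued S)
  decompose {S} (S-ind , ∣S∣) with Vec.splitAt (n G) S
  ... | xs , ys , refl with independent-++⁻ S-ind
  ...   | xs-ind , ys-ind , ys⊆ with pathComplement-independent ys-ind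
  ...     | inj₁ ∣ys∣≤1 =
    contradiction (≤-trans (≤-reflexive (sym ∣S∣)) too-small) (<⇒≱ (+-monoʳ-< k ≤-refl))
    where
    too-small : ∣ xs ++ ys ∣ ≤ k + 1
    too-small = ≤-trans (≤-reflexive (∣p++q∣≡∣p∣+∣q∣ xs ys)) (+-mono-≤ (α≤k xs xs-ind) ∣ys∣≤1)
  ...     | inj₂ (j , v , refl) =
    xs , j , glued refl (xs-ind , ∣xs∣≡k) v (at j (≤-trans (n≤1+n _) v) (inj₁ refl) , at (suc j) v (inj₂ refl))
    where
    ∣xs∣≡k : ∣ xs ∣ ≡ k
    ∣xs∣≡k = +-cancelʳ-≡ 2 _ k (trans (cong (∣ xs ∣ +_) (sym (∣pair∣≡2 j v)))
                                      (trans (sym (∣p++q∣≡∣p∣+∣q∣ xs (pair m j))) ∣S∣))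
    at : ∀ x (x<m : x < m) → x ≡ j ⊎ x ≡ suc j → xs ⊆ lock x
    at x x<m x∈ = subst (λ y → xs ⊆ lock y) (toℕ-fromℕ< x<m)
      (ys⊆ (fromℕ< x<m) (∈pair⁺ j _ (subst (λ y → y ≡ j ⊎ y ≡ suc j) (sym (toℕ-fromℕ< x<m)) x∈)))

  level : ℕ → Fin 3 → ℕ → ℕ
  level t s r = toℕ s + (r + t * (3 + δ))

  data Tracked (S : Subset (n H)) (p : ℕ) : Set where
    tracked : ∀ {t s xs r} → Glued S xs (toℕ s + t * 3) → SetWalk G k (anchor t) xs r →
              level t s r ≤ p → Tracked S p

  tracked-forward : ∀ {S xs t r p} (s : Fin 3) → Glued S xs (suc (toℕ s + t * 3)) →
                    SetWalk G k (anchor t) xs r → level t s r ≤ p → Tracked S (suc p)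
  tracked-forward {t = t} zero       g trail bound = tracked {t = t} {s = suc zero} g trail (s≤s bound)
  tracked-forward {t = t} (suc zero) g trail bound = tracked {t = t} {s = suc (suc zero)} g trail (s≤s bound)
  tracked-forward {xs = xs} {t} {r} (suc (suc zero)) g@(glued _ (_ , ∣xs∣) _ (xs⊆ , _)) trail bound =
    tracked {t = suc t} {s = zero} g (subst (λ X → SetWalk G k X xs 0) xs≡ done)
      (s≤s (≤-trans (+-monoʳ-≤ 2 (+-monoˡ-≤ (t * (3 + δ)) δ≤r)) bound))
    where
    xs≡ : xs ≡ anchor (suc t)
    xs≡ = anchor-fix (suc t) (subst (xs ⊆_) (zoneLock-anchor A B (suc t)) xs⊆) ∣xs∣
    δ≤r : δ ≤ r
    δ≤r = SetDistance.minimal (anchor-distance t) (subst (λ X → SetWalk G k (anchor t) X r) xs≡ trail)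
  tracked-forward (suc (suc (suc ()))) _ _ _

  tracked-backward : ∀ {S xs j t r p} (s : Fin 3) → toℕ s + t * 3 ≡ suc j → Glued S xs j →
                     SetWalk G k (anchor t) xs r → level t s r ≤ p → Tracked S (suc p)
  tracked-backward {t = zero} zero ()
  tracked-backward {xs = xs} {t = suc t} {r} zero refl g@(glued _ (_ , ∣xs∣) _ (_ , xs⊆)) _ bound =
    tracked {t = t} {s = suc (suc zero)} g
      (subst (λ X → SetWalk G k (anchor t) X δ) (sym xs≡) (SetDistance.walk (anchor-distance t)))
      (m≤n⇒m≤1+n (≤-trans (≤-trans (n≤1+n _) (m≤n+m _ r)) bound))
    where
    xs≡ : xs ≡ anchor (suc t)
    xs≡ = anchor-fix (suc t) (subst (xs ⊆_) (zoneLock-anchor A B (suc t)) xs⊆) ∣xs∣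
  tracked-backward {t = t} (suc zero) refl g trail bound =
    tracked {t = t} {s = zero} g trail (m≤n⇒m≤1+n (≤-trans (n≤1+n _) bound))
  tracked-backward {t = t} (suc (suc zero)) refl g trail bound =
    tracked {t = t} {s = suc zero} g trail (m≤n⇒m≤1+n (≤-trans (n≤1+n _) bound))
  tracked-backward (suc (suc (suc ()))) _ _ _ _

  tracked-jump : ∀ {S S′ p} → Tracked S p → IsKIndep H (k + 2) S′ → TokenJump (k + 2) S S′ →
                 Tracked S′ (suc p)
  tracked-jump (tracked {t} {s} {xs} (glued refl xs-ind v _) trail bound) S′-ind J with decompose S′-ind
  ... | xs′ , j′ , g′@(glued refl xs′-ind v′ _)
    with pair-move {xs = xs} {xs′} {toℕ s + t * 3} {j′} (proj₂ xs-ind) (proj₂ xs′-ind) v v′ J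
  ...   | jumpˡ refl xs⇝xs′ =
    tracked {t = t} {s = s} g′ (snoc trail xs′-ind xs⇝xs′)
      (≤-trans (≤-reflexive (+-suc (toℕ s) _)) (s≤s bound))
  ...   | slide⁺ refl refl   = tracked-forward {t = t} s g′ trail bound
  ...   | slide⁻ refl j≡1+j′ = tracked-backward {t = t} s j≡1+j′ g′ trail bound

  tracked-start : Tracked (A ++ pair m 0) 0
  tracked-start = tracked {t = 0} {s = zero} (glued refl A-ind (s≤s (s≤s z≤n)) (anchor-compatible₀ 0)) done z≤n

  tracked-end : ∀ {Y p} → Tracked (Y ++ pair m (T * 3)) p → T * (3 + δ) ≤ p
  tracked-end {Y} (tracked {t} {s} {xs} {r} (glued split _ v _) _ bound) =
    ≤-trans (*-monoˡ-≤ (3 + δ) T≤t) (≤-trans (≤-trans (m≤n+m _ r) (m≤n+m _ (toℕ s))) bound)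
    where
    T≤t : T ≤ t
    T≤t = zone-≤ s t T (pair-injective (T * 3) _ ≤-refl v (++-injectiveʳ Y xs split))

  slide : ∀ {xs j} → IsKIndep G k xs → 3 + j ≤ m → Compatible xs (suc j) →
          SetWalk H (k + 2) (xs ++ pair m j) (xs ++ pair m (suc j)) 1
  slide {xs} {j} xs-ind@(_ , ∣xs∣) v c = jump (glued-ind xs-ind v c) one-token done
    where
    ∣xs∩xs∣ : ∣ xs ∩ xs ∣ ≡ k
    ∣xs∩xs∣ = trans (cong ∣_∣ (∩-idem xs)) ∣xs∣
    one-token : TokenJump (k + 2) (xs ++ pair m j) (xs ++ pair m (suc j))
    one-token = begin
      suc ∣ (xs ++ pair m j) ∩ (xs ++ pair m (suc j)) ∣   ≡⟨ cong suc (∣p++q∩r++s∣ xs xs (pair m j) _) ⟩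
      suc (∣ xs ∩ xs ∣ + ∣ pair m j ∩ pair m (suc j) ∣)    ≡⟨ cong₂ (λ a c → suc (a + c)) ∣xs∩xs∣
                                                                   (∣pair∩pair-suc∣≡1 j v) ⟩
      suc (k + 1)                                        ≡⟨ +-suc k 1 ⟨
      k + 2                                              ∎
      where open ≡-Reasoning

  lift : ∀ {I J j ℓ} → 2 + j ≤ m → (∀ xs → Compatible xs j) →
         SetWalk G k I J ℓ → SetWalk H (k + 2) (I ++ pair m j) (J ++ pair m j) ℓ
  lift v free done = done
  lift {I} {j = j} v free (jump {J = X} X-ind I⇝X w) =
    jump (glued-ind X-ind v (free X)) (trans (cong suc (∣p++q∩r++s∣ I X (pair m j) (pair m j)))
                                             (cong₂ _+_ I⇝X (∣pair∩pair∣≡2 j v)))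
         (lift v free w)

  Reachable : Subset (n H) → Subset (n H) → Set
  Reachable S S′ = ∃[ ℓ ] SetWalk H (k + 2) S S′ ℓ

  cross-zone : ∀ t → suc t ≤ T → Reachable (anchor t ++ pair m (t * 3)) (anchor (suc t) ++ pair m (suc t * 3))
  cross-zone t t<T = _ ,
    slide (anchor-ind t) v₀ (free-compatible t _) ++ʷ
    (lift v₀ (free-compatible t) (SetDistance.walk (anchor-distance t)) ++ʷ
    (slide (anchor-ind (suc t)) v₁ (anchor-compatible₂ t) ++ʷ
     slide (anchor-ind (suc t)) v₂ (anchor-compatible₀ (suc t))))
    where
    v₂ : 5 + t * 3 ≤ m
    v₂ = s≤s (s≤s (*-monoˡ-≤ 3 t<T))
    v₁ : 4 + t * 3 ≤ m
    v₁ = ≤-trans (n≤1+n _) v₂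
    v₀ : 3 + t * 3 ≤ m
    v₀ = ≤-trans (n≤1+n _) v₁

  route : ∀ t → t ≤ T → Reachable (A ++ pair m 0) (anchor t ++ pair m (t * 3))
  route zero    _   = 0 , done
  route (suc t) t<T with route t (≤-trans (n≤1+n t) t<T) | cross-zone t t<T
  ... | ℓ , w | ℓ′ , w′ = ℓ + ℓ′ , w ++ʷ w′

  start : Conf H (k + 2)
  start = A ++ pair m 0 , glued-ind A-ind (s≤s (s≤s z≤n)) (anchor-compatible₀ 0)

  walk-length : ∀ {Y ℓ} → SetWalk H (k + 2) (A ++ pair m 0) (Y ++ pair m (T * 3)) ℓ → T * (3 + δ) ≤ ℓ
  walk-length w = subst (T * (3 + δ) ≤_) (+-identityʳ _)
                    (tracked-end (potential-walk Tracked tracked-jump w tracked-start))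

  diameter : DiameterAtLeast H (k + 2) (T * (3 + δ))
  diameter with route T ≤-refl
  ... | ℓ , w with toWalk start w
  ...   | end , end≡ , w′ = start , end , (ℓ , w′) , λ ℓ′ ℓ′<T[3+δ] w″ →
    <⇒≱ ℓ′<T[3+δ] (walk-length (subst (λ S → SetWalk H (k + 2) _ S ℓ′) end≡ (fromWalk w″)))

mainTheorem8 : (G : Graph) (k d : ℕ) → IndependenceNumber G k → HasDiameter G k d →
    (n : ℕ) → 1 ≤ n →
    ∃[ H ] (∣V∣ H ≡ ∣V∣ G + 6 * n + 2 × DiameterAtLeast H (k + 2) (2 * d * n))
mainTheorem8 G k d (_ , α≤k) (_ , I , J , dist) n _ with DistEq⇒SetDistance I J dist
... | δ , d≤2+δ , I↔J = H , vertex-count (∣V∣ G) n , DiameterAtLeast-mono 2dn≤ diameter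
  where
  open Construction G k α≤k (proj₂ I) (proj₂ J) I↔J (2 * n)
  vertex-count : ∀ a b → a + (2 + 2 * b * 3) ≡ a + 6 * b + 2
  vertex-count = solve-∀
  2dn≤ : 2 * d * n ≤ 2 * n * (3 + δ)
  2dn≤ = begin
    2 * d * n     ≡⟨ *-assoc 2 d n ⟩
    2 * (d * n)   ≡⟨ cong (2 *_) (*-comm d n) ⟩
    2 * (n * d)   ≡⟨ *-assoc 2 n d ⟨
    2 * n * d     ≤⟨ *-monoʳ-≤ (2 * n) (m≤n⇒m≤1+n d≤2+δ) ⟩
    2 * n * (3 + δ) ∎
    where open ≤-Reasoning
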